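{- Let $r\geq2$ and $1\le i\le r$. Let $x_\lambda=x_{n_{1,1}}\,(x_{n_{2,1}}\cdots x_{n_{2,f(2)}})\cdots(x_{n_{r-1,1}}\cdots x_{n_{r-1,f(r-1)}})\,(x_{n_{r,1}}\cdots x_{n_{r,\ell}})$ with $0\leq\ell<f(r)$, where the indices are positive integers with $n_{1,1}\le n_{2,1}\le\dots\le n_{r-1,f(r-1)}\le n_{r,1}\le\dots\le n_{r,\ell}$, and $f(1)=1$, $f(j)=n_{j-1,f(j-1)}$ for $2\le j\le i$, $f(j)=n_{j-1,f(j-1)}-1$ for $i+1\le j\le r$. Let $\lambda$ be the partition whose parts are these indices. If $1\leq i\leq r-1$, let $d$ be the height of the first horizontal Durfee rectangle of $\lambda$; if $i=r$, let $d$ be the side of the first Durfee square of $\lambda$. Then this first Durfee rectangle (resp. square) ends in the $(r-1)$-th block of $x_\lambda$, that is, $\ell<d\leq f(r-1)+\ell$ (so that deleting the first $d$ parts of $\lambda$ leaves the monomial $x_{n_{1,1}}\cdots x_{n_{r-2,f(r-2)}}x_{n_{r-1,1}}\cdots x_{n_{r-1,\ell'}}$ with $0\le\ell'<f(r-1)$).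
   Context: To a partition $\lambda=(\lambda_1,\dots,\lambda_s)$ (non-increasing sequence of positive integers) is associated the monomial $x_\lambda=x_{\lambda_1}\cdots x_{\lambda_s}$ in $\mathbf{K}[x_1,x_2,\dots]$; the largest parts of $\lambda$ (its first rows) correspond to the last variables in the non-decreasing ordering of indices. The blocks of $x_\lambda$ are the parenthesized groups (block 1 being $x_{n_{1,1}}$). The side of the Durfee square of $\lambda$ is $\max\{d\ge0: d\le s,\ \lambda_d\ge d\}$; the height of its horizontal Durfee rectangle is $\max\{h\ge0: h\le s,\ \lambda_h\ge h+1\}$ (largest rectangle with $h$ rows and $h+1$ columns in the top-left corner of the Young diagram). -}

module Defs where

open import Data.Nat using (ℕ; zero; suc; _+_; _∸_; _≤ᵇ_; _<ᵇ_)
open import Data.Bool using (Bool; if_then_else_)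
open import Data.List using (List; []; _∷_; length; reverse; concat)

-- 1-indexed access into a list, with a default value outside the range.
at : {A : Set} → A → List A → ℕ → A
at dflt []       _             = dflt
at dflt (x ∷ xs) zero          = dflt
at dflt (x ∷ xs) (suc zero)    = x
at dflt (x ∷ xs) (suc (suc k)) = at dflt xs (suc k)

lastOr : ℕ → List ℕ → ℕ
lastOr d []           = d
lastOr d (x ∷ [])     = x
lastOr d (x ∷ y ∷ xs) = lastOr d (y ∷ xs)

-- The j-th block (1-indexed) of the monomial, given as a list of blocks;
-- each block is the list of indices n_{j,1} ≤ … ≤ n_{j,length}.
blk : List (List ℕ) → ℕ → List ℕ
blk bs j = at [] bs j

fOf : ℕ → List (List ℕ) → ℕ → ℕ
fOf i bs zero          = 0
fOf i bs (suc zero)    = 1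
fOf i bs (suc (suc k)) =
  if suc (suc k) ≤ᵇ i
  then lastOr 0 (blk bs (suc k))
  else lastOr 0 (blk bs (suc k)) ∸ 1

-- The partition lam attached to the monomial: its parts are all the indices,
-- listed in non-increasing order (λ_1 = largest index).
partitionOf : List (List ℕ) → List ℕ
partitionOf bs = reverse (concat bs)

part : List ℕ → ℕ → ℕ
part lam k = at 0 lam k

maxDurfee : ℕ → List ℕ → ℕ → ℕ
maxDurfee c lam zero    = 0
maxDurfee c lam (suc d) =
  if suc d + c ≤ᵇ part lam (suc d) then suc d else maxDurfee c lam d

durfeeSquare : List ℕ → ℕ
durfeeSquare lam = maxDurfee 0 lam (length lam)

durfeeRect : List ℕ → ℕ
durfeeRect lam = maxDurfee 1 lam (length lam)

-- Let c = 1 for the horizontal Durfee rectangle and c = 0 for the Durfee square.  The definition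
-- of f gives f(r) ≤ N - c, where N = n_{r-1,f(r-1)}, and n_{r-2,f(r-2)} ≤ f(r-1) + c.
-- Read from its largest part, λ consists of the ℓ parts of block r, then N, the rest of block r-1,
-- and the earlier blocks.  Since ℓ < f(r), the part λ_{ℓ+1} = N is at least ℓ + 1 + c, so d > ℓ.
-- Every part after position f(r-1) + ℓ comes from blocks 1, …, r-2, hence by monotonicity is at
-- most n_{r-2,f(r-2)} ≤ f(r-1) + c and so smaller than its position plus c, whence d ≤ f(r-1) + ℓ.
module Submission where

open import Defs
open import Data.Nat
open import Data.Nat.Properties
open import Data.Bool using (true; false; if_then_else_)
open import Data.Product using (_×_; _,_; Σ-syntax)
open import Data.Sum using (inj₁; inj₂)
open import Data.List using (List; []; _∷_; length; concat; reverse; _++_; _∷ʳ_)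
open import Data.List.Properties
  using (length-++; ++-assoc; ++-identityʳ; reverse-++; unfold-reverse; length-reverse; concat-++)
open import Data.List.Relation.Unary.All using (All; []; _∷_)
import Data.List.Relation.Unary.All as All
import Data.List.Relation.Unary.All.Properties as All
open import Data.List.Relation.Unary.Linked using (Linked; _∷_)
open import Relation.Binary.PropositionalEquality
open import Relation.Nullary using (yes; no; ofʸ; ofⁿ; contradiction)

at-++ʳ : ∀ {A : Set} (d : A) xs ys n → at d (xs ++ ys) (suc n + length xs) ≡ at d ys (suc n)
at-++ʳ d xs ys n rewrite +-comm n (length xs) = shift xs
  where
  shift : ∀ xs → at d (xs ++ ys) (suc (length xs + n)) ≡ at d ys (suc n)
  shift []       = refl
  shift (x ∷ xs) = shift xs

at-≤ : ∀ {m} ys k → All (_≤ m) ys → at 0 ys k ≤ m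
at-≤ []       k             _          = z≤n
at-≤ (y ∷ ys) zero          _          = z≤n
at-≤ (y ∷ ys) (suc zero)    (y≤m ∷ _)  = y≤m
at-≤ (y ∷ ys) (suc (suc k)) (_ ∷ ys≤m) = at-≤ ys (suc k) ys≤m

at-++-≤ : ∀ {m} xs ys k → All (_≤ m) ys → length xs < k → at 0 (xs ++ ys) k ≤ m
at-++-≤ []       ys k             ys≤m _         = at-≤ ys k ys≤m
at-++-≤ (x ∷ xs) ys (suc (suc k)) ys≤m (s≤s len<) = at-++-≤ xs ys (suc k) ys≤m len<

at-pos⇒≤length : ∀ xs k → 0 < at 0 xs k → k ≤ length xs
at-pos⇒≤length (x ∷ xs) (suc zero)    _   = s≤s z≤n
at-pos⇒≤length (x ∷ xs) (suc (suc k)) pos = s≤s (at-pos⇒≤length xs (suc k) pos)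

durfee : ℕ → List ℕ → ℕ
durfee c lam = maxDurfee c lam (length lam)

maxDurfee-≥ : ∀ c lam m d → suc d ≤ m → suc d + c ≤ part lam (suc d) → suc d ≤ maxDurfee c lam m
maxDurfee-≥ c lam (suc m) d d<m big
  with suc m + c ≤ᵇ part lam (suc m) | ≤ᵇ-reflects-≤ (suc m + c) (part lam (suc m))
... | true  | _        = d<m
... | false | ofⁿ small with m≤n⇒m<n∨m≡n d<m
...   | inj₁ d<m′ = maxDurfee-≥ c lam m d (≤-pred d<m′) big
...   | inj₂ refl = contradiction big small

maxDurfee-≤ : ∀ c lam m q → (∀ d → q < d → part lam d < d + c) → maxDurfee c lam m ≤ q
maxDurfee-≤ c lam zero    q small = z≤n
maxDurfee-≤ c lam (suc m) q small
  with suc m + c ≤ᵇ part lam (suc m) | ≤ᵇ-reflects-≤ (suc m + c) (part lam (suc m))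
... | false | _       = maxDurfee-≤ c lam m q small
... | true  | ofʸ big with suc m ≤? q
...   | yes m<q = m<q
...   | no  m≮q = contradiction big (<⇒≱ (small (suc m) (≰⇒> m≮q)))

durfee-bounds : ∀ c lam p q → suc p + c ≤ part lam (suc p) → (∀ d → q < d → part lam d < d + c) →
  p < durfee c lam × durfee c lam ≤ q
durfee-bounds c lam p q big small =
  maxDurfee-≥ c lam (length lam) p (at-pos⇒≤length lam (suc p) (≤-trans (s≤s z≤n) big)) big
  , maxDurfee-≤ c lam (length lam) q small

All-reverse⁺ : ∀ {P : ℕ → Set} xs → All P xs → All P (reverse xs)
All-reverse⁺ []       []         = []
All-reverse⁺ (x ∷ xs) (px ∷ pxs) =
  subst (All _) (sym (unfold-reverse x xs)) (All.++⁺ (All-reverse⁺ xs pxs) (px ∷ []))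

reverse-lastOr : ∀ b bs → Σ[ T ∈ List ℕ ] reverse (b ∷ bs) ≡ lastOr 0 (b ∷ bs) ∷ T
reverse-lastOr b []        = [] , refl
reverse-lastOr b (b′ ∷ bs) with T , eq ← reverse-lastOr b′ bs =
  T ∷ʳ b , trans (unfold-reverse b (b′ ∷ bs)) (cong (_∷ʳ b) eq)

durfee-reverse-blocks : ∀ c P B C → suc (length C + c) ≤ lastOr 0 B → All (_≤ length B + c) P →
  length C < durfee c (reverse (P ++ B ++ C)) × durfee c (reverse (P ++ B ++ C)) ≤ length B + length C
durfee-reverse-blocks c P []       C ()    P-small
durfee-reverse-blocks c P (b ∷ bs) C N-big P-small
  with T , reverse-B ← reverse-lastOr b bs =
  subst (λ lam → length C < durfee c lam × durfee c lam ≤ length B + length C)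
        (sym parts) (durfee-bounds c lam (length C) (length B + length C) big small)
  where
  B = b ∷ bs
  N = lastOr 0 B
  top = reverse C ++ N ∷ T
  lam = top ++ reverse P
  parts : reverse (P ++ B ++ C) ≡ lam
  parts = begin
    reverse (P ++ B ++ C)                 ≡⟨ reverse-++ P (B ++ C) ⟩
    reverse (B ++ C) ++ reverse P         ≡⟨ cong (_++ reverse P) (reverse-++ B C) ⟩
    (reverse C ++ reverse B) ++ reverse P ≡⟨ cong (λ R → (reverse C ++ R) ++ reverse P) reverse-B ⟩
    lam                                   ∎
    where open ≡-Reasoning
  length-top : length top ≡ length B + length C
  length-top = begin
    length top                           ≡⟨ length-++ (reverse C) ⟩
    length (reverse C) + length (N ∷ T)  ≡⟨ cong₂ _+_ (length-reverse C) (cong length (sym reverse-B)) ⟩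
    length C + length (reverse B)        ≡⟨ cong (length C +_) (length-reverse B) ⟩
    length C + length B                  ≡⟨ +-comm (length C) (length B) ⟩
    length B + length C                  ∎
    where open ≡-Reasoning
  N-position : part lam (suc (length C)) ≡ N
  N-position = begin
    at 0 lam (suc (length C))                   ≡⟨ cong (λ k → at 0 lam (suc k)) (length-reverse C) ⟨
    at 0 lam (suc (length (reverse C)))         ≡⟨ cong (λ l → at 0 l (suc (length (reverse C))))
                                                        (++-assoc (reverse C) (N ∷ T) (reverse P)) ⟩
    at 0 (reverse C ++ N ∷ T ++ reverse P) (suc (length (reverse C)))
                                                ≡⟨ at-++ʳ 0 (reverse C) (N ∷ T ++ reverse P) 0 ⟩
    N                                           ∎
    where open ≡-Reasoning
  big : suc (length C) + c ≤ part lam (suc (length C))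
  big = subst (suc (length C) + c ≤_) (sym N-position) N-big
  small : ∀ d → length B + length C < d → part lam d < d + c
  small d B+C<d = ≤-<-trans
    (at-++-≤ top (reverse P) d (All-reverse⁺ P P-small) (subst (_< d) (sym length-top) B+C<d))
    (+-monoˡ-< c (≤-<-trans (m≤m+n (length B) (length C)) B+C<d))

lastOr-++ : ∀ xs ys → 1 ≤ length ys → lastOr 0 (xs ++ ys) ≡ lastOr 0 ys
lastOr-++ []            ys       _  = refl
lastOr-++ (x ∷ [])      (y ∷ ys) _  = refl
lastOr-++ (x ∷ x′ ∷ xs) ys       ne = lastOr-++ (x′ ∷ xs) ys ne

Linked-++⇒All-≤-lastOr : ∀ xs ys → Linked _≤_ (xs ++ ys) → All (_≤ lastOr 0 xs) xs
Linked-++⇒All-≤-lastOr []            ys _              = []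
Linked-++⇒All-≤-lastOr (x ∷ [])      ys _              = ≤-refl ∷ []
Linked-++⇒All-≤-lastOr (x ∷ x′ ∷ xs) ys (x≤x′ ∷ sorted)
  with x′≤last ∷ xs≤last ← Linked-++⇒All-≤-lastOr (x′ ∷ xs) ys sorted =
  ≤-trans x≤x′ x′≤last ∷ x′≤last ∷ xs≤last

durfeeOffset : ℕ → ℕ → ℕ
durfeeOffset i r = if i <ᵇ r then 1 else 0

durfee-selected : ∀ i r bs →
  (if i <ᵇ r then durfeeRect (partitionOf bs) else durfeeSquare (partitionOf bs))
    ≡ durfee (durfeeOffset i r) (reverse (concat bs))
durfee-selected i r bs with i <ᵇ r
... | true  = refl
... | false = refl

suc-+-durfeeOffset-≤ : ∀ i r N ℓ → ℓ < (if r ≤ᵇ i then N else N ∸ 1) →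
  suc (ℓ + durfeeOffset i r) ≤ N
suc-+-durfeeOffset-≤ i r N ℓ ℓ<
  with r ≤ᵇ i | ≤ᵇ-reflects-≤ r i | i <ᵇ r | <ᵇ-reflects-< i r
... | true  | ofʸ r≤i | true  | ofʸ i<r = contradiction r≤i (<⇒≱ i<r)
... | true  | _       | false | _       = subst (λ x → suc x ≤ N) (sym (+-identityʳ ℓ)) ℓ<
... | false | _       | true  | _       =
  m≤o∸n⇒m+n≤o (suc ℓ) (≤-trans (s≤s z≤n) (≤-trans ℓ< (m∸n≤m N 1))) ℓ<
... | false | _       | false | _       =
  subst (λ x → suc x ≤ N) (sym (+-identityʳ ℓ)) (≤-trans ℓ< (m∸n≤m N 1))

≤-+-durfeeOffset : ∀ i j M → M ≤ (if j ≤ᵇ i then M else M ∸ 1) + durfeeOffset i (suc j)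
≤-+-durfeeOffset i j M with j ≤ᵇ i | ≤ᵇ-reflects-≤ j i
... | true  | _       = m≤m+n M _
... | false | ofⁿ j≰i with i <ᵇ suc j | <ᵇ-reflects-< i (suc j)
...   | true  | _        = subst (M ≤_) (+-comm 1 (M ∸ 1)) (m≤n+m∸n M 1)
...   | false | ofⁿ i≮1+j = contradiction (m<n⇒m<1+n (≰⇒> j≰i)) i≮1+j

split-last-three : ∀ k (bs : List (List ℕ)) → length bs ≡ 3 + k →
  Σ[ pre ∈ List (List ℕ) ] Σ[ A ∈ List ℕ ] Σ[ B ∈ List ℕ ] Σ[ C ∈ List ℕ ]
    bs ≡ pre ++ A ∷ B ∷ C ∷ [] × length pre ≡ k
split-last-three zero    (A ∷ B ∷ C ∷ []) refl = [] , A , B , C , refl , refl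
split-last-three (suc k) (A′ ∷ bs)        len
  with pre , A , B , C , refl , refl ← split-last-three k bs (suc-injective len) =
  A′ ∷ pre , A , B , C , refl , refl

concat-last-three : ∀ pre (A B C : List ℕ) →
  concat (pre ++ A ∷ B ∷ C ∷ []) ≡ (concat pre ++ A) ++ B ++ C
concat-last-three pre A B C = begin
  concat (pre ++ A ∷ B ∷ C ∷ [])  ≡⟨ concat-++ pre (A ∷ B ∷ C ∷ []) ⟨
  concat pre ++ A ++ B ++ C ++ [] ≡⟨ cong (λ C′ → concat pre ++ A ++ B ++ C′) (++-identityʳ C) ⟩
  concat pre ++ A ++ B ++ C       ≡⟨ ++-assoc (concat pre) A (B ++ C) ⟨
  (concat pre ++ A) ++ B ++ C     ∎
  where open ≡-Reasoning

DurfeeEndsInPenultimateBlock : ℕ → ℕ → List (List ℕ) → Set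
DurfeeEndsInPenultimateBlock i r bs =
  length (blk bs r) < (if i <ᵇ r then durfeeRect (partitionOf bs) else durfeeSquare (partitionOf bs))
  × (if i <ᵇ r then durfeeRect (partitionOf bs) else durfeeSquare (partitionOf bs))
      ≤ fOf i bs (r ∸ 1) + length (blk bs r)

durfee-ends-in-block : ∀ i k bs P B C →
  concat bs ≡ P ++ B ++ C → blk bs (1 + k) ≡ B → blk bs (2 + k) ≡ C →
  length (blk bs (1 + k)) ≡ fOf i bs (1 + k) → length (blk bs (2 + k)) < fOf i bs (2 + k) →
  Linked _≤_ (concat bs) → lastOr 0 P ≤ length B + durfeeOffset i (2 + k) →
  DurfeeEndsInPenultimateBlock i (2 + k) bs
durfee-ends-in-block i k bs P B C blocks blk-B blk-C length-B short sorted last-P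
  rewrite durfee-selected i (2 + k) bs | blocks | blk-C | trans (sym length-B) (cong length blk-B) =
  durfee-reverse-blocks (durfeeOffset i (2 + k)) P B C N-big P-small
  where
  N-big : suc (length C + durfeeOffset i (2 + k)) ≤ lastOr 0 B
  N-big = subst (λ B′ → suc (length C + durfeeOffset i (2 + k)) ≤ lastOr 0 B′) blk-B
            (suc-+-durfeeOffset-≤ i (2 + k) _ _ short)
  P-small : All (_≤ length B + durfeeOffset i (2 + k)) P
  P-small = All.map (λ x≤ → ≤-trans x≤ last-P)
              (Linked-++⇒All-≤-lastOr P (B ++ C) sorted)

durfee-ends-in-last-three : ∀ i pre A B C → let bs = pre ++ A ∷ B ∷ C ∷ [] ; k = length pre in
  1 ≤ length (blk bs (1 + k)) → length (blk bs (2 + k)) ≡ fOf i bs (2 + k) →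
  length (blk bs (3 + k)) < fOf i bs (3 + k) → Linked _≤_ (concat bs) →
  DurfeeEndsInPenultimateBlock i (3 + k) bs
durfee-ends-in-last-three i pre A B C A-nonempty length-B short sorted =
  durfee-ends-in-block i (1 + k) bs (concat pre ++ A) B C
    (concat-last-three pre A B C) blk-B (at-++ʳ [] pre ABC 2) length-B short sorted last-A
  where
  k = length pre
  ABC = A ∷ B ∷ C ∷ []
  bs = pre ++ ABC
  blk-A : blk bs (1 + k) ≡ A
  blk-A = at-++ʳ [] pre ABC 0
  blk-B : blk bs (2 + k) ≡ B
  blk-B = at-++ʳ [] pre ABC 1
  A-nonempty′ : 1 ≤ length A
  A-nonempty′ = subst (λ A′ → 1 ≤ length A′) blk-A A-nonempty
  fOf≡length-B : fOf i bs (2 + k) ≡ length B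
  fOf≡length-B = trans (sym length-B) (cong length blk-B)
  last-A : lastOr 0 (concat pre ++ A) ≤ length B + durfeeOffset i (3 + k)
  last-A = begin
    lastOr 0 (concat pre ++ A)                  ≡⟨ lastOr-++ (concat pre) A A-nonempty′ ⟩
    lastOr 0 A                                  ≡⟨ cong (lastOr 0) blk-A ⟨
    lastOr 0 (blk bs (1 + k))                   ≤⟨ ≤-+-durfeeOffset i (2 + k) _ ⟩
    fOf i bs (2 + k) + durfeeOffset i (3 + k)   ≡⟨ cong (_+ durfeeOffset i (3 + k)) fOf≡length-B ⟩
    length B + durfeeOffset i (3 + k)           ∎
    where open ≤-Reasoning

lemma4p2 : (r i : ℕ) (bs : List (List ℕ)) →
    2 ≤ r → 1 ≤ i → i ≤ r →
    length bs ≡ r →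
    (∀ j → 1 ≤ j → j < r → 1 ≤ length (blk bs j)) →
    (∀ j → 1 ≤ j → j < r → length (blk bs j) ≡ fOf i bs j) →
    length (blk bs r) < fOf i bs r →
    All (1 ≤_) (concat bs) →
    Linked _≤_ (concat bs) →
    length (blk bs r) < (if i <ᵇ r then durfeeRect (partitionOf bs) else durfeeSquare (partitionOf bs))
    × (if i <ᵇ r then durfeeRect (partitionOf bs) else durfeeSquare (partitionOf bs))
    ≤ fOf i bs (r ∸ 1) + length (blk bs r)
lemma4p2 0 i bs ()       _ _ _ _ _ _ _ _
lemma4p2 1 i bs (s≤s ()) _ _ _ _ _ _ _ _
lemma4p2 2 i (B ∷ C ∷ []) _ _ _ _ _ lengths short _ sorted =
  durfee-ends-in-block i 0 (B ∷ C ∷ []) [] B C (cong (B ++_) (++-identityʳ C)) refl refl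
    (lengths 1 ≤-refl ≤-refl) short sorted z≤n
lemma4p2 (suc (suc (suc k))) i bs _ _ _ len nonempty lengths short _ sorted
  with pre , A , B , C , refl , refl ← split-last-three k bs len =
  durfee-ends-in-last-three i pre A B C
    (nonempty (1 + k) (s≤s z≤n) (m<n⇒m<1+n ≤-refl))
    (lengths (2 + k) (s≤s z≤n) ≤-refl) short sorted
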